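{- For every strongly binary $2$-matroid $Z$ there is a unique strongly binary $2$-sheltering matroid $Q$ such that $\mathcal{Z}(Q)=Z$.
   Context: Let $\Omega$ be a partition of a finite set $U$. Subtransversals (transversals) of $\Omega$ are sets meeting each class in at most (exactly) one element; a skew pair is a $2$-element subset of a class. A multimatroid over $(U,\Omega)$ is $(U,\Omega,\mathcal{I})$ with $\mathcal{I}$ a family of subtransversals such that for each transversal $T$, $(T,\mathcal{I}\cap 2^T)$ is a matroid (by independent sets), and for any $I\in\mathcal{I}$ and skew pair $\{x,y\}$ of a class disjoint from $I$, $I\cup\{x\}\in\mathcal{I}$ or $I\cup\{y\}\in\mathcal{I}$. A $2$-matroid is a multimatroid in which every class has exactly two elements. A sheltering matroid is a pair $Q=(M,\Omega)$, $M$ a matroid on $U$, such that for any subtransversal $I$ independent in $M$ and skew pair $\{x,y\}$ of a class disjoint from $I$, $I\cup\{x\}$ or $I\cup\{y\}$ is independent in $M$; $\mathcal{Z}(Q)$ is the multimatroid whose independent sets are the subtransversals independent in $M$. For a $2$-partition $\Omega$, a transversal $2$-tuple $\tau=(T_1,T_2)$ (two disjoint transversals) and a skew-symmetric matrix $A$ over a field $\mathbb{F}$ indexed by the classes of $\Omega$, let $M$ be the column matroid of $\begin{pmatrix} I & A\end{pmatrix}$, where the $I$ columns are indexed by $T_1$ and the $A$ columns by $T_2$ (each identified with the classes); then $\mathcal{Q}(A,\tau,2)=(M,\Omega)$ is a $2$-sheltering matroid. A $2$-sheltering matroid is strongly binary if it equals $\mathcal{Q}(A,\tau,2)$ for some skew-symmetric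 (over $GF(2)$: symmetric) matrix $A$ over $GF(2)$ and transversal $2$-tuple $\tau$. A $2$-matroid $Z$ is strongly binary if $Z=\mathcal{Z}(Q)$ for some strongly binary $2$-sheltering matroid $Q$. -}

module Defs where

open import Data.Nat using (ℕ; _<_; _+_)
open import Data.Bool using (Bool; true; false; _xor_; _∧_; not; _≟_)
open import Data.Fin using (Fin; zero; suc)
import Data.Fin as F
open import Data.Fin.Subset as S using (Subset; ∣_∣; ⁅_⁆; _∪_)
open import Data.Vec using (lookup)
open import Data.Product using (Σ; _×_; _,_; proj₁; proj₂)
open import Data.Sum using (_⊎_)
open import Relation.Binary.PropositionalEquality using (_≡_)
open import Relation.Nullary using (¬_; ⌊_⌋)

-- Ground set U = Fin n × Bool; the partition Ω has the n classes
-- ω i = {(i , false) , (i , true)}  (every class has exactly two elements).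
El : ℕ → Set
El n = Fin n × Bool

-- A subset X of U is a pair of subsets of Fin n:
-- (i , false) ∈ X iff i ∈ proj₁ X, (i , true) ∈ X iff i ∈ proj₂ X.
Sub : ℕ → Set
Sub n = Subset n × Subset n

part : ∀ {n} → Bool → Sub n → Subset n
part false X = proj₁ X
part true  X = proj₂ X

infix 4 _∈ₛ_ _⊆ₛ_
_∈ₛ_ : ∀ {n} → El n → Sub n → Set
(i , b) ∈ₛ X = lookup (part b X) i ≡ true

_⊆ₛ_ : ∀ {n} → Sub n → Sub n → Set
X ⊆ₛ Y = ∀ e → e ∈ₛ X → e ∈ₛ Y

size : ∀ {n} → Sub n → ℕ
size X = ∣ proj₁ X ∣ + ∣ proj₂ X ∣

∅ₛ : ∀ {n} → Sub n
∅ₛ = S.⊥ , S.⊥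

singleton : ∀ {n} → El n → Sub n
singleton (i , false) = ⁅ i ⁆ , S.⊥
singleton (i , true)  = S.⊥ , ⁅ i ⁆

insert : ∀ {n} → El n → Sub n → Sub n
insert e X = (proj₁ X ∪ proj₁ (singleton e)) , (proj₂ X ∪ proj₂ (singleton e))

Family : ℕ → Set₁
Family n = Sub n → Set

SameFam : ∀ {n} → Family n → Family n → Set
SameFam F G = ∀ X → (F X → G X) × (G X → F X)

-- Matroid given by its independent sets (on the ground set containing all
-- its members; for the restriction to a transversal T we conjoin "X ⊆ T").
record IsMatroid {n : ℕ} (I : Family n) : Set where
  field
    empty-ind : I ∅ₛ
    down-closed : ∀ X Y → Y ⊆ₛ X → I X → I Y
    augment : ∀ X Y → I X → I Y → size X < size Y →
              Σ (El n) λ e → (e ∈ₛ Y) × (¬ (e ∈ₛ X)) × I (insert e X)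

IsSubtransversal : ∀ {n} → Sub n → Set
IsSubtransversal {n} X = (i : Fin n) → ¬ (((i , false) ∈ₛ X) × ((i , true) ∈ₛ X))

IsTransversal : ∀ {n} → Sub n → Set
IsTransversal {n} X = (i : Fin n) →
  (((i , false) ∈ₛ X) × ¬ ((i , true) ∈ₛ X)) ⊎ (¬ ((i , false) ∈ₛ X) × ((i , true) ∈ₛ X))

ClassDisjoint : ∀ {n} → Fin n → Sub n → Set
ClassDisjoint i X = ¬ ((i , false) ∈ₛ X) × ¬ ((i , true) ∈ₛ X)

-- 2-matroid over (U , Ω): a multimatroid where every class has two elements
-- (the only skew pair of class ω i is ω i itself).
record Is2Matroid {n : ℕ} (I : Family n) : Set₁ where
  field
    subtransversal : ∀ X → I X → IsSubtransversal X
    transversal-matroid : ∀ T → IsTransversal T → IsMatroid (λ X → I X × X ⊆ₛ T)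
    skew : ∀ X (i : Fin n) → I X → ClassDisjoint i X →
           I (insert (i , false) X) ⊎ I (insert (i , true) X)

record IsSheltering {n : ℕ} (M : Family n) : Set₁ where
  field
    matroid : IsMatroid M
    shelter : ∀ X (i : Fin n) → IsSubtransversal X → M X → ClassDisjoint i X →
              M (insert (i , false) X) ⊎ M (insert (i , true) X)

𝒵 : ∀ {n} → Family n → Family n
𝒵 M X = IsSubtransversal X × M X

-- GF(2) = Bool with xor / ∧.  Sum over Fin n.
bigxor : ∀ {n} → (Fin n → Bool) → Bool
bigxor {ℕ.zero} f = false
bigxor {ℕ.suc n} f = f zero xor bigxor (λ i → f (suc i))

-- Entry in row k of the column of (I A) indexed by element (i , b), where the
-- transversal 2-tuple τ = (T₁ , T₂) is given by s : T₁ = {(i , s i)},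
-- T₂ = {(i , not (s i))}; the I columns are indexed by T₁, the A columns by T₂.
colEntry : ∀ {n} → (Fin n → Fin n → Bool) → (Fin n → Bool) → El n → Fin n → Bool
colEntry A s (i , b) k with ⌊ b ≟ s i ⌋
... | true  = ⌊ k F.≟ i ⌋
... | false = A k i

combo : ∀ {n} → (Fin n → Fin n → Bool) → (Fin n → Bool) → Sub n → Fin n → Bool
combo A s c k = bigxor (λ i →
  (lookup (proj₁ c) i ∧ colEntry A s (i , false) k) xor
  (lookup (proj₂ c) i ∧ colEntry A s (i , true) k))

-- Column matroid of (I A): X independent iff its columns are linearly
-- independent over GF(2), i.e. the only coefficient vector supported in X
-- giving the zero combination is the zero vector.
ColIndep : ∀ {n} → (Fin n → Fin n → Bool) → (Fin n → Bool) → Family n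
ColIndep {n} A s X = ∀ (c : Sub n) → c ⊆ₛ X → (∀ k → combo A s c k ≡ false) → c ≡ ∅ₛ

-- Symmetric (= skew-symmetric over GF(2)) n × n matrix over GF(2).
IsSymmetric : ∀ {n} → (Fin n → Fin n → Bool) → Set
IsSymmetric {n} A = ∀ (i j : Fin n) → A i j ≡ A j i

IsStronglyBinaryRep : ∀ {n} → Family n → Set
IsStronglyBinaryRep {n} M =
  Σ (Fin n → Fin n → Bool) λ A → Σ (Fin n → Bool) λ s →
    IsSymmetric A × SameFam M (ColIndep A s)

IsStronglyBinarySheltering : ∀ {n} → Family n → Set₁
IsStronglyBinarySheltering M = IsSheltering M × IsStronglyBinaryRep M

IsStronglyBinary2Matroid : ∀ {n} → Family n → Set₁
IsStronglyBinary2Matroid {n} Z =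
  Σ (Family n) λ M → IsStronglyBinarySheltering M × SameFam (𝒵 M) Z

module Submission where

-- Let 𝒬(A, s), 𝒬(A', s') be column matroids of (I | A), (I | A') over GF(2),
-- A, A' symmetric, with the same independent subtransversals.  Write x s i
-- for the element of class i carrying the identity column, y s i for the
-- other one, and T₀ s = {x s i}.  T₀ s is independent in 𝒬(A, s), hence in
-- 𝒬(A', s').  Since 𝒬(A', s') has rank n (rank-bound), T₀ s ∪ {y s i} is
-- dependent there, and an explicit dependency writes each column y s i of
-- (I | A') through the columns of T₀ s: 𝒬(A', s') = 𝒬(B, s) for some B.
-- The null space of (I | A') is isotropic for the symplectic form ω, which
-- forces B to be symmetric.  Finally the transversals T s F are independent
-- exactly when the principal submatrices B[F] are nonsingular, and the 1×1
-- and 2×2 principal minors determine a symmetric matrix: B = A.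

open import Defs
open import Data.Nat using (ℕ)
open import Data.Product using (Σ; _×_)

open import Algebra.Bundles using (CommutativeRing)
open import Data.Bool using (Bool; true; false; _xor_; _∧_; _∨_; not; if_then_else_)
import Data.Bool as Bool
open import Data.Bool.Properties
  using ( xor-∧-commutativeRing; xor-comm; xor-same; xor-identityʳ; not-injective; ¬-not
        ; ∧-comm; ∧-assoc; ∧-idem; ∧-zeroʳ; ∧-identityʳ; ∧-inverseˡ; ∧-inverseʳ
        ; ∧-distribˡ-xor; ∧-distribʳ-xor; ∨-zeroʳ )
open import Data.Empty using (⊥-elim)
open import Data.Fin as Fin using (Fin; zero; suc)
import Data.Fin.Properties as Finₚ
open import Data.Fin.Subset as Subset using (Subset; ∣_∣)
open import Data.Fin.Subset.Properties using (anySubset?; Empty-unique; x∈⁅x⁆)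
open import Data.Nat using (zero; suc; _<_; _≤_; _+_; z≤n; s≤s)
open import Data.Nat.Properties using (+-comm; +-mono-≤; +-mono-<-≤; +-mono-≤-<; +-commutativeSemigroup)
open import Data.Product using (_,_; proj₁; proj₂)
open import Data.Vec using (lookup; tabulate)
open import Data.Vec.Properties using (lookup∘tabulate; lookup-replicate; lookup-zipWith; []=⇒lookup; ≡-dec)
open import Function.Base using (_∘_)
open import Function.Bundles using (_⇔_; mk⇔; Equivalence)
import Function.Properties.Equivalence as ⇔
open import Relation.Nullary using (¬_; yes; no; Dec; ⌊_⌋)
open import Relation.Nullary.Decidable using (_×-dec_; _→-dec_; ¬?)
open import Relation.Binary.PropositionalEquality
open import Algebra.Properties.CommutativeSemigroup (CommutativeRing.+-commutativeSemigroup xor-∧-commutativeRing) using () renaming (interchange to xor-interchange)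
open import Algebra.Properties.CommutativeSemigroup +-commutativeSemigroup using () renaming (interchange to +-interchange)

open Equivalence using (to; from)
open ≡-Reasoning

-- Matrices over GF(2), vectors indexed by U, and column systems: column e
-- of a system v is the vector r ↦ v e r of GF(2)ⁿ.
Matrix : ℕ → Set
Matrix n = Fin n → Fin n → Bool

Coeff : ℕ → Set
Coeff n = El n → Bool

Columns : ℕ → Set
Columns n = El n → Fin n → Bool

false≢true : false ≢ true
false≢true ()

xor-cancelˡ : ∀ a {b c} → a xor b ≡ a xor c → b ≡ c
xor-cancelˡ false eq = eq
xor-cancelˡ true  eq = not-injective eq

xor≡false⇒≡ : ∀ a b → a xor b ≡ false → a ≡ b
xor≡false⇒≡ a b eq = xor-cancelˡ a (trans (xor-same a) (sym eq))

-- If a = 1 implies b = 1 and b = 0, then a = 0: coefficients vanish off their support.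
outside-support : ∀ {a b} → (a ≡ true → b ≡ true) → b ≡ false → a ≡ false
outside-support {false} _ _ = refl
outside-support {true}  h b≡false = trans (sym (h refl)) b≡false

bool-ext : ∀ {a b} → (a ≡ true ⇔ b ≡ true) → a ≡ b
bool-ext {false} {false} _ = refl
bool-ext {false} {true}  e = from e refl
bool-ext {true}  {false} e = sym (to e refl)
bool-ext {true}  {true}  _ = refl

∧-trueˡ : ∀ {a b} → a ∧ b ≡ true → a ≡ true
∧-trueˡ {true} _ = refl

-- Finite sums over Fin n in GF(2) (Defs.bigxor) and the Kronecker delta.

Σ-cong : ∀ {n} {f g : Fin n → Bool} → (∀ i → f i ≡ g i) → bigxor f ≡ bigxor g
Σ-cong {zero}  h = refl
Σ-cong {suc n} h = cong₂ _xor_ (h zero) (Σ-cong (λ i → h (suc i)))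

Σ-xor : ∀ {n} (f g : Fin n → Bool) → bigxor (λ i → f i xor g i) ≡ bigxor f xor bigxor g
Σ-xor {zero}  f g = refl
Σ-xor {suc n} f g =
  trans (cong ((f zero xor g zero) xor_) (Σ-xor (λ i → f (suc i)) (λ i → g (suc i))))
        (xor-interchange (f zero) (g zero) _ _)

Σ-zero : ∀ {n} (f : Fin n → Bool) → (∀ i → f i ≡ false) → bigxor f ≡ false
Σ-zero {zero}  f h = refl
Σ-zero {suc n} f h rewrite h zero = Σ-zero (λ i → f (suc i)) (λ i → h (suc i))

Σ-scaleˡ : ∀ {n} a (f : Fin n → Bool) → a ∧ bigxor f ≡ bigxor (λ i → a ∧ f i)
Σ-scaleˡ {zero}  a f = ∧-zeroʳ a
Σ-scaleˡ {suc n} a f =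
  trans (∧-distribˡ-xor a (f zero) _) (cong ((a ∧ f zero) xor_) (Σ-scaleˡ a (λ i → f (suc i))))

Σ-scaleʳ : ∀ {n} a (f : Fin n → Bool) → bigxor f ∧ a ≡ bigxor (λ i → f i ∧ a)
Σ-scaleʳ a f = trans (∧-comm _ a) (trans (Σ-scaleˡ a f) (Σ-cong (λ i → ∧-comm a (f i))))

Σ-swap : ∀ {n m} (f : Fin n → Fin m → Bool) →
  bigxor (λ i → bigxor (λ j → f i j)) ≡ bigxor (λ j → bigxor (λ i → f i j))
Σ-swap {zero}  {m} f = sym (Σ-zero {m} _ (λ j → refl))
Σ-swap {suc n}     f = trans (cong (bigxor (f zero) xor_) (Σ-swap (λ i → f (suc i))))
                             (sym (Σ-xor (f zero) (λ j → bigxor (λ i → f (suc i) j))))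

Σ-single : ∀ {n} (f : Fin n → Bool) r → (∀ i → i ≢ r → f i ≡ false) → bigxor f ≡ f r
Σ-single {suc n} f zero h =
  trans (cong (f zero xor_) (Σ-zero _ (λ i → h (suc i) (λ ())))) (xor-identityʳ _)
Σ-single {suc n} f (suc r) h rewrite h zero (λ ()) =
  Σ-single (λ i → f (suc i)) r (λ i i≢r → h (suc i) (i≢r ∘ Finₚ.suc-injective))

δ : ∀ {n} → Fin n → Fin n → Bool
δ i j = ⌊ i Fin.≟ j ⌋

δ-refl : ∀ {n} (i : Fin n) → δ i i ≡ true
δ-refl i with i Fin.≟ i
... | yes _  = refl
... | no i≢i = ⊥-elim (i≢i refl)

δ-ne : ∀ {n} {i j : Fin n} → i ≢ j → δ i j ≡ false
δ-ne {i = i} {j} i≢j with i Fin.≟ j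
... | yes i≡j = ⊥-elim (i≢j i≡j)
... | no _    = refl

δ-true : ∀ {n} {i j : Fin n} → δ i j ≡ true → i ≡ j
δ-true {i = i} {j} h with i Fin.≟ j
... | yes i≡j = i≡j

δ-sym : ∀ {n} (i j : Fin n) → δ i j ≡ δ j i
δ-sym i j with i Fin.≟ j
... | yes refl = sym (δ-refl i)
... | no i≢j   = sym (δ-ne (i≢j ∘ sym))

Σ-pickˡ : ∀ {n} (g : Fin n → Bool) r → bigxor (λ j → δ j r ∧ g j) ≡ g r
Σ-pickˡ g r = trans (Σ-single _ r (λ j j≢r → cong (_∧ g j) (δ-ne j≢r))) (cong (_∧ g r) (δ-refl r))

Σ-pickʳ : ∀ {n} (g : Fin n → Bool) r → bigxor (λ j → g j ∧ δ j r) ≡ g r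
Σ-pickʳ g r = trans (Σ-cong (λ j → ∧-comm (g j) (δ j r))) (Σ-pickˡ g r)

Σ-pair : ∀ {n} (f : Fin n → Bool) i k → i ≢ k → (∀ j → j ≢ i → j ≢ k → f j ≡ false) →
  bigxor f ≡ f i xor f k
Σ-pair f i k i≢k h =
  trans (Σ-cong split) (trans (Σ-xor (λ j → δ j i ∧ f j) (λ j → δ j k ∧ f j))
                              (cong₂ _xor_ (Σ-pickˡ f i) (Σ-pickˡ f k)))
  where
  split : ∀ j → f j ≡ (δ j i ∧ f j) xor (δ j k ∧ f j)
  split j with j Fin.≟ i | j Fin.≟ k
  ... | yes refl | yes refl = ⊥-elim (i≢k refl)
  ... | yes refl | no _     = sym (xor-identityʳ _)
  ... | no _     | yes refl = refl
  ... | no j≢i   | no j≢k   = h j j≢i j≢k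

-- Subsets of U as indicator functions.

∨-singleton : ∀ {n} a (i : Fin n) → a ∨ lookup Subset.⁅ i ⁆ i ≡ true
∨-singleton a i = trans (cong (a ∨_) ([]=⇒lookup (x∈⁅x⁆ i))) (∨-zeroʳ a)

⟦_⟧ : ∀ {n} → Sub n → Coeff n
⟦ X ⟧ (i , b) = lookup (part b X) i

toSub : ∀ {n} → Coeff n → Sub n
toSub f = tabulate (λ i → f (i , false)) , tabulate (λ i → f (i , true))

⟦toSub⟧ : ∀ {n} (f : Coeff n) e → ⟦ toSub f ⟧ e ≡ f e
⟦toSub⟧ f (i , false) = lookup∘tabulate _ i
⟦toSub⟧ f (i , true)  = lookup∘tabulate _ i

⟦∅ₛ⟧ : ∀ {n} (e : El n) → ⟦ ∅ₛ ⟧ e ≡ false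
⟦∅ₛ⟧ (i , false) = lookup-replicate i false
⟦∅ₛ⟧ (i , true)  = lookup-replicate i false

≡∅ₛ : ∀ {n} (c : Sub n) → (∀ e → ⟦ c ⟧ e ≡ false) → c ≡ ∅ₛ
≡∅ₛ (c₁ , c₂) h = cong₂ _,_ (empty (λ i → h (i , false))) (empty (λ i → h (i , true)))
  where
  empty : ∀ {n} {p : Subset n} → (∀ i → lookup p i ≡ false) → p ≡ Subset.⊥
  empty h = Empty-unique (λ (i , i∈p) → false≢true (trans (sym (h i)) ([]=⇒lookup i∈p)))

⟦insert⟧-new : ∀ {n} (e : El n) X → ⟦ insert e X ⟧ e ≡ true
⟦insert⟧-new (i , false) X = trans (lookup-zipWith _∨_ i (proj₁ X) _) (∨-singleton (lookup (proj₁ X) i) i)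
⟦insert⟧-new (i , true)  X = trans (lookup-zipWith _∨_ i (proj₂ X) _) (∨-singleton (lookup (proj₂ X) i) i)

⟦insert⟧-old : ∀ {n} (e : El n) X e' → ⟦ X ⟧ e' ≡ true → ⟦ insert e X ⟧ e' ≡ true
⟦insert⟧-old e X (i , false) h = trans (lookup-zipWith _∨_ i (proj₁ X) _) (cong (_∨ _) h)
⟦insert⟧-old e X (i , true)  h = trans (lookup-zipWith _∨_ i (proj₂ X) _) (cong (_∨ _) h)

dec⊆ₛ : ∀ {n} (c X : Sub n) → Dec (c ⊆ₛ X)
dec⊆ₛ c X with Finₚ.all? (λ i → ((⟦ c ⟧ (i , false) Bool.≟ true) →-dec (⟦ X ⟧ (i , false) Bool.≟ true))
                          ×-dec ((⟦ c ⟧ (i , true) Bool.≟ true) →-dec (⟦ X ⟧ (i , true) Bool.≟ true)))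
... | yes h  = yes λ { (i , false) → proj₁ (h i) ; (i , true) → proj₂ (h i) }
... | no ¬h  = no λ h → ¬h (λ i → h (i , false) , h (i , true))

dec≡∅ₛ : ∀ {n} (c : Sub n) → Dec (c ≡ ∅ₛ)
dec≡∅ₛ (c₁ , c₂) with ≡-dec Bool._≟_ c₁ Subset.⊥ | ≡-dec Bool._≟_ c₂ Subset.⊥
... | yes refl | yes refl = yes refl
... | no c₁≢⊥  | _        = no (c₁≢⊥ ∘ cong proj₁)
... | yes _    | no c₂≢⊥  = no (c₂≢⊥ ∘ cong proj₂)

bit : Bool → ℕ
bit false = 0
bit true  = 1

Σℕ : ∀ {n} → (Fin n → ℕ) → ℕ
Σℕ {zero}  f = 0
Σℕ {suc n} f = f zero + Σℕ (λ i → f (suc i))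

∣tabulate∣ : ∀ {n} (g : Fin n → Bool) → ∣ tabulate g ∣ ≡ Σℕ (λ i → bit (g i))
∣tabulate∣ {zero}  g = refl
∣tabulate∣ {suc n} g with g zero
... | true  = cong suc (∣tabulate∣ (λ i → g (suc i)))
... | false = ∣tabulate∣ (λ i → g (suc i))

Σℕ-+ : ∀ {n} (f g : Fin n → ℕ) → Σℕ f + Σℕ g ≡ Σℕ (λ i → f i + g i)
Σℕ-+ {zero}  f g = refl
Σℕ-+ {suc n} f g = trans (+-interchange (f zero) _ (g zero) _)
                         (cong (f zero + g zero +_) (Σℕ-+ (λ i → f (suc i)) (λ i → g (suc i))))

Σℕ-mono : ∀ {n} (f g : Fin n → ℕ) → (∀ i → f i ≤ g i) → Σℕ f ≤ Σℕ g
Σℕ-mono {zero}  f g h = z≤n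
Σℕ-mono {suc n} f g h = +-mono-≤ (h zero) (Σℕ-mono _ _ (λ i → h (suc i)))

Σℕ-strict : ∀ {n} (f g : Fin n → ℕ) i → (∀ j → f j ≤ g j) → f i < g i → Σℕ f < Σℕ g
Σℕ-strict {suc n} f g zero    h lt = +-mono-<-≤ lt (Σℕ-mono _ _ (λ j → h (suc j)))
Σℕ-strict {suc n} f g (suc i) h lt = +-mono-≤-< (h zero) (Σℕ-strict _ _ i (λ j → h (suc j)) lt)

classSize : ∀ {n} → Coeff n → Fin n → ℕ
classSize f j = bit (f (j , false)) + bit (f (j , true))

size-toSub : ∀ {n} (f : Coeff n) → size (toSub f) ≡ Σℕ (classSize f)
size-toSub f = trans (cong₂ _+_ (∣tabulate∣ (λ i → f (i , false))) (∣tabulate∣ (λ i → f (i , true))))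
                     (Σℕ-+ (λ i → bit (f (i , false))) (λ i → bit (f (i , true))))

x : ∀ {n} → (Fin n → Bool) → Fin n → El n
x s i = i , s i

y : ∀ {n} → (Fin n → Bool) → Fin n → El n
y s i = i , not (s i)

glue : ∀ {n} → (Fin n → Bool) → (Fin n → Bool) → (Fin n → Bool) → Coeff n
glue s cx cy (i , b) = if ⌊ b Bool.≟ s i ⌋ then cx i else cy i

glue-x : ∀ {n} s cx cy (j : Fin n) → glue s cx cy (x s j) ≡ cx j
glue-x s cx cy j with s j
... | true  = refl
... | false = refl

glue-y : ∀ {n} s cx cy (j : Fin n) → glue s cx cy (y s j) ≡ cy j
glue-y s cx cy j with s j
... | true  = refl
... | false = refl

El-elim : ∀ {n ℓ} (s : Fin n → Bool) (P : El n → Set ℓ) →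
  (∀ j → P (x s j)) → (∀ j → P (y s j)) → ∀ e → P e
El-elim s P px py (j , b) with b Bool.≟ s j
... | yes refl = px j
... | no b≢sj  = subst (λ b → P (j , b)) (sym (¬-not b≢sj)) (py j)

T : ∀ {n} → (Fin n → Bool) → (Fin n → Bool) → Coeff n
T s F = glue s (λ j → not (F j)) F

T₀ : ∀ {n} → (Fin n → Bool) → Coeff n
T₀ s = T s (λ _ → false)

T₀⁺ : ∀ {n} → (Fin n → Bool) → Fin n → Coeff n
T₀⁺ s i = glue s (λ _ → true) (λ j → δ j i)

T-x : ∀ {n} s (F : Fin n → Bool) j → T s F (x s j) ≡ not (F j)
T-x s F = glue-x s (λ j → not (F j)) F

T-y : ∀ {n} s (F : Fin n → Bool) j → T s F (y s j) ≡ F j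
T-y s F = glue-y s (λ j → not (F j)) F

T₀-x : ∀ {n} (s : Fin n → Bool) j → T₀ s (x s j) ≡ true
T₀-x s = T-x s (λ _ → false)

T₀⁺-y : ∀ {n} (s : Fin n → Bool) i j → T₀⁺ s i (y s j) ≡ δ j i
T₀⁺-y s i = glue-y s (λ _ → true) (λ j → δ j i)

T-subtransversal : ∀ {n} (s F : Fin n → Bool) → IsSubtransversal (toSub (T s F))
T-subtransversal s F i (in₁ , in₂) =
  false≢true (trans (sym (disjoint i)) (cong₂ _∧_ (trans (sym (⟦toSub⟧ (T s F) (i , false))) in₁)
                                                  (trans (sym (⟦toSub⟧ (T s F) (i , true))) in₂)))
  where
  disjoint : ∀ i → T s F (i , false) ∧ T s F (i , true) ≡ false
  disjoint i with s i
  ... | true  = ∧-inverseʳ (F i)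
  ... | false = ∧-inverseˡ (F i)

classSize-T₀ : ∀ {n} (s : Fin n → Bool) j → classSize (T₀ s) j ≡ 1
classSize-T₀ s j with s j
... | true  = refl
... | false = refl

classSize-T₀⁺ : ∀ {n} (s : Fin n → Bool) i j → classSize (T₀⁺ s i) j ≡ suc (bit (δ j i))
classSize-T₀⁺ s i j with s j
... | true  = +-comm (bit (δ j i)) 1
... | false = refl

size-T₀<size-T₀⁺ : ∀ {n} (s s' : Fin n → Bool) i → size (toSub (T₀ s)) < size (toSub (T₀⁺ s' i))
size-T₀<size-T₀⁺ s s' i =
  subst₂ _<_ (sym (size-toSub (T₀ s))) (sym (size-toSub (T₀⁺ s' i)))
    (Σℕ-strict _ _ i
      (λ j → subst₂ _≤_ (sym (classSize-T₀ s j)) (sym (classSize-T₀⁺ s' i j)) (s≤s z≤n))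
      (subst₂ _<_ (sym (classSize-T₀ s i)) (sym (trans (classSize-T₀⁺ s' i i) (cong (suc ∘ bit) (δ-refl i))))
              (s≤s (s≤s z≤n))))

-- Linear algebra of column systems.

_⊑_ : ∀ {n} → Coeff n → Coeff n → Set
c ⊑ X = ∀ e → c e ≡ true → X e ≡ true

combine : ∀ {n} → Columns n → Coeff n → Fin n → Bool
combine v c r = bigxor (λ i → (c (i , false) ∧ v (i , false) r) xor (c (i , true) ∧ v (i , true) r))

IsNull : ∀ {n} → Columns n → Coeff n → Set
IsNull v c = ∀ r → combine v c r ≡ false

Independent : ∀ {n} → Columns n → Coeff n → Set
Independent v X = ∀ c → c ⊑ X → IsNull v c → ∀ e → c e ≡ false

lin : ∀ {n} → Matrix n → (Fin n → Bool) → Fin n → Bool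
lin p z r = bigxor (λ k → z k ∧ p k r)

Free : ∀ {n} → Matrix n → Set
Free p = ∀ z → (∀ r → lin p z r ≡ false) → ∀ k → z k ≡ false

xcols : ∀ {n} → Columns n → (Fin n → Bool) → Matrix n
xcols v s i r = v (x s i) r

coord : ∀ {n} → (Fin n → Bool) → Matrix n → Coeff n → Fin n → Bool
coord s B c k = c (x s k) xor bigxor (λ j → c (y s j) ∧ B k j)

same-null-space : ∀ {n} (v w : Columns n) → (∀ c → IsNull v c ⇔ IsNull w c) →
  ∀ X → Independent v X ⇔ Independent w X
same-null-space v w nulls X =
  mk⇔ (λ ind c c⊑X null → ind c c⊑X (from (nulls c) null))
      (λ ind c c⊑X null → ind c c⊑X (to (nulls c) null))

Independent-≗ : ∀ {n} (v : Columns n) {X X'} → (∀ e → X e ≡ X' e) → Independent v X ⇔ Independent v X'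
Independent-≗ v X≗X' =
  mk⇔ (λ ind c c⊑X' → ind c (λ e ce → trans (X≗X' e) (c⊑X' e ce)))
      (λ ind c c⊑X → ind c (λ e ce → trans (sym (X≗X' e)) (c⊑X e ce)))

combine-cong : ∀ {n} (v : Columns n) {c d} → (∀ e → c e ≡ d e) → ∀ r → combine v c r ≡ combine v d r
combine-cong v c≗d r = Σ-cong (λ i → cong₂ _xor_ (cong (_∧ _) (c≗d (i , false))) (cong (_∧ _) (c≗d (i , true))))

colIndep⇔independent : ∀ {n} (A : Matrix n) s X → ColIndep A s X ⇔ Independent (colEntry A s) ⟦ X ⟧
colIndep⇔independent A s X = mk⇔ to-fun (λ ind c c⊆X null → ≡∅ₛ c (ind ⟦ c ⟧ c⊆X null))
  where
  to-fun : ColIndep A s X → Independent (colEntry A s) ⟦ X ⟧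
  to-fun ci c c⊑X null e = begin
    c e              ≡⟨ sym (⟦toSub⟧ c e) ⟩
    ⟦ toSub c ⟧ e    ≡⟨ cong (λ d → ⟦ d ⟧ e) (ci (toSub c) sub null') ⟩
    ⟦ ∅ₛ ⟧ e         ≡⟨ ⟦∅ₛ⟧ e ⟩
    false            ∎
    where
    sub : toSub c ⊆ₛ X
    sub e h = c⊑X e (trans (sym (⟦toSub⟧ c e)) h)
    null' : ∀ r → combo A s (toSub c) r ≡ false
    null' r = trans (combine-cong (colEntry A s) (⟦toSub⟧ c) r) (null r)

colIndep-toSub : ∀ {n} (A : Matrix n) s f → ColIndep A s (toSub f) ⇔ Independent (colEntry A s) f
colIndep-toSub A s f = ⇔.trans (colIndep⇔independent A s (toSub f)) (Independent-≗ (colEntry A s) (⟦toSub⟧ f))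

combine-split : ∀ {n} (v : Columns n) s c r →
  combine v c r ≡ lin (xcols v s) (λ k → c (x s k)) r xor bigxor (λ j → c (y s j) ∧ v (y s j) r)
combine-split v s c r =
  trans (Σ-cong per-class) (Σ-xor (λ i → c (x s i) ∧ v (x s i) r) (λ i → c (y s i) ∧ v (y s i) r))
  where
  per-class : ∀ i → ((c (i , false) ∧ v (i , false) r) xor (c (i , true) ∧ v (i , true) r))
                  ≡ ((c (x s i) ∧ v (x s i) r) xor (c (y s i) ∧ v (y s i) r))
  per-class i with s i
  ... | true  = xor-comm (c (i , false) ∧ v (i , false) r) (c (i , true) ∧ v (i , true) r)
  ... | false = refl

colEntry-x : ∀ {n} s (B : Matrix n) i k → colEntry B s (x s i) k ≡ δ k i
colEntry-x s B i k with s i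
... | true  = refl
... | false = refl

colEntry-y : ∀ {n} s (B : Matrix n) i k → colEntry B s (y s i) k ≡ B k i
colEntry-y s B i k with s i
... | true  = refl
... | false = refl

combine-colEntry : ∀ {n} s (B : Matrix n) c k → combine (colEntry B s) c k ≡ coord s B c k
combine-colEntry s B c k = begin
  combine (colEntry B s) c k
    ≡⟨ combine-split (colEntry B s) s c k ⟩
  bigxor (λ i → c (x s i) ∧ colEntry B s (x s i) k) xor bigxor (λ j → c (y s j) ∧ colEntry B s (y s j) k)
    ≡⟨ cong₂ _xor_ x-part (Σ-cong (λ j → cong (c (y s j) ∧_) (colEntry-y s B j k))) ⟩
  coord s B c k ∎
  where
  x-part : bigxor (λ i → c (x s i) ∧ colEntry B s (x s i) k) ≡ c (x s k)
  x-part = trans (Σ-cong (λ i → cong (c (x s i) ∧_) (trans (colEntry-x s B i k) (δ-sym k i))))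
                 (Σ-pickʳ (λ i → c (x s i)) k)

colEntry-null-cong : ∀ {n} s (B B' : Matrix n) → (∀ i k → B i k ≡ B' i k) →
  ∀ c → IsNull (colEntry B s) c ⇔ IsNull (colEntry B' s) c
colEntry-null-cong s B B' B≗B' c = mk⇔ (λ null r → trans (sym (same r)) (null r)) (λ null r → trans (same r) (null r))
  where
  same : ∀ r → combine (colEntry B s) c r ≡ combine (colEntry B' s) c r
  same r = trans (combine-colEntry s B c r)
           (trans (cong (c (x s r) xor_) (Σ-cong (λ j → cong (c (y s j) ∧_) (B≗B' r j))))
                  (sym (combine-colEntry s B' c r)))

null-with-zero-y : ∀ {n} s (B : Matrix n) c → IsNull (colEntry B s) c → (∀ j → c (y s j) ≡ false) →
  ∀ e → c e ≡ false
null-with-zero-y s B c null y-zero = El-elim s (λ e → c e ≡ false) x-zero y-zero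
  where
  x-zero : ∀ k → c (x s k) ≡ false
  x-zero k = begin
    c (x s k)                                        ≡⟨ sym (xor-identityʳ _) ⟩
    c (x s k) xor false                              ≡⟨ cong (c (x s k) xor_) (sym (Σ-zero _ (λ j → cong (_∧ B k j) (y-zero j)))) ⟩
    coord s B c k                                    ≡⟨ sym (combine-colEntry s B c k) ⟩
    combine (colEntry B s) c k                       ≡⟨ null k ⟩
    false                                            ∎

-- Change of basis: if the y-columns of v are combinations of the columns of
-- T₀ s with coefficients in the columns of B, every combination of v is the
-- corresponding combination of (I | B) written in the basis xcols v s.
change-of-basis : ∀ {n} (v : Columns n) s (B : Matrix n) →
  (∀ i r → v (y s i) r ≡ lin (xcols v s) (λ k → B k i) r) →
  ∀ c r → combine v c r ≡ lin (xcols v s) (combine (colEntry B s) c) r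
change-of-basis {n} v s B spans c r = begin
  combine v c r
    ≡⟨ combine-split v s c r ⟩
  lin p (λ k → c (x s k)) r xor bigxor (λ j → c (y s j) ∧ v (y s j) r)
    ≡⟨ cong (lin p (λ k → c (x s k)) r xor_) y-part ⟩
  lin p (λ k → c (x s k)) r xor lin p (λ k → bigxor (λ j → c (y s j) ∧ B k j)) r
    ≡⟨ sym (Σ-xor (λ k → c (x s k) ∧ p k r) (λ k → bigxor (λ j → c (y s j) ∧ B k j) ∧ p k r)) ⟩
  bigxor (λ k → (c (x s k) ∧ p k r) xor (bigxor (λ j → c (y s j) ∧ B k j) ∧ p k r))
    ≡⟨ Σ-cong (λ k → sym (∧-distribʳ-xor (p k r) (c (x s k)) _)) ⟩
  lin p (coord s B c) r
    ≡⟨ Σ-cong (λ k → cong (_∧ p k r) (sym (combine-colEntry s B c k))) ⟩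
  lin p (combine (colEntry B s) c) r ∎
  where
  p : Matrix n
  p = xcols v s
  y-part : bigxor (λ j → c (y s j) ∧ v (y s j) r) ≡ lin p (λ k → bigxor (λ j → c (y s j) ∧ B k j)) r
  y-part = begin
    bigxor (λ j → c (y s j) ∧ v (y s j) r)
      ≡⟨ Σ-cong (λ j → trans (cong (c (y s j) ∧_) (spans j r)) (Σ-scaleˡ (c (y s j)) (λ k → B k j ∧ p k r))) ⟩
    bigxor (λ j → bigxor (λ k → c (y s j) ∧ (B k j ∧ p k r)))
      ≡⟨ Σ-swap (λ j k → c (y s j) ∧ (B k j ∧ p k r)) ⟩
    bigxor (λ k → bigxor (λ j → c (y s j) ∧ (B k j ∧ p k r)))
      ≡⟨ Σ-cong (λ k → trans (Σ-cong (λ j → sym (∧-assoc (c (y s j)) (B k j) (p k r))))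
                             (sym (Σ-scaleʳ (p k r) (λ j → c (y s j) ∧ B k j)))) ⟩
    lin p (λ k → bigxor (λ j → c (y s j) ∧ B k j)) r ∎

null-space-via-basis : ∀ {n} (v : Columns n) s (B : Matrix n) → Free (xcols v s) →
  (∀ i r → v (y s i) r ≡ lin (xcols v s) (λ k → B k i) r) →
  ∀ c → IsNull v c ⇔ IsNull (colEntry B s) c
null-space-via-basis v s B free spans c =
  mk⇔ (λ null → free _ (λ r → trans (sym (change-of-basis v s B spans c r)) (null r)))
      (λ null r → trans (change-of-basis v s B spans c r)
                        (Σ-zero _ (λ k → cong (_∧ xcols v s k r) (null k))))

transversal-free : ∀ {n} (v : Columns n) s → Independent v (T₀ s) → Free (xcols v s)
transversal-free {n} v s ind z z-null k = trans (sym (glue-x s z zero-y k)) (ind c c⊑T₀ c-null (x s k))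
  where
  zero-y : Fin n → Bool
  zero-y _ = false
  c : Coeff n
  c = glue s z zero-y
  c⊑T₀ : c ⊑ T₀ s
  c⊑T₀ = El-elim s (λ e → c e ≡ true → T₀ s e ≡ true) (λ j _ → T₀-x s j)
                     (λ j h → ⊥-elim (false≢true (trans (sym (glue-y s z zero-y j)) h)))
  c-null : IsNull v c
  c-null r = begin
    combine v c r
      ≡⟨ combine-split v s c r ⟩
    lin (xcols v s) (λ k → c (x s k)) r xor bigxor (λ j → c (y s j) ∧ v (y s j) r)
      ≡⟨ cong₂ _xor_ (Σ-cong (λ k → cong (_∧ _) (glue-x s z zero-y k)))
                     (Σ-zero _ (λ j → cong (_∧ _) (glue-y s z zero-y j))) ⟩
    lin (xcols v s) z r xor false
      ≡⟨ xor-identityʳ _ ⟩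
    lin (xcols v s) z r
      ≡⟨ z-null r ⟩
    false ∎

-- A dependent set contains an explicit nonzero null vector (finite search).
explicit-dependency : ∀ {n} (A : Matrix n) s (X : Sub n) → ¬ ColIndep A s X →
  Σ (Sub n) λ c → c ⊆ₛ X × (∀ r → combo A s c r ≡ false) × ¬ c ≡ ∅ₛ
explicit-dependency A s X dependent
  with anySubset? (λ c₁ → anySubset? (λ c₂ → witness? (c₁ , c₂)))
  where
  witness? : ∀ c → Dec (c ⊆ₛ X × (∀ r → combo A s c r ≡ false) × ¬ c ≡ ∅ₛ)
  witness? c = dec⊆ₛ c X ×-dec Finₚ.all? (λ r → combo A s c r Bool.≟ false) ×-dec ¬? (dec≡∅ₛ c)
... | yes (c₁ , c₂ , w) = (c₁ , c₂) , w
... | no none = ⊥-elim (dependent independent)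
  where
  independent : ColIndep A s X
  independent c c⊆X null with dec≡∅ₛ c
  ... | yes c≡∅ = c≡∅
  ... | no c≢∅  = ⊥-elim (none (proj₁ c , proj₂ c , c⊆X , null , c≢∅))

column-in-span : ∀ {n} (v : Columns n) s i → Independent v (T₀ s) →
  ∀ c → c ⊑ T₀⁺ s i → IsNull v c → ¬ (∀ e → c e ≡ false) →
  ∀ r → v (y s i) r ≡ lin (xcols v s) (λ k → c (x s k)) r
column-in-span {n} v s i ind c c⊑T₀⁺ null nonzero r = sym (xor≡false⇒≡ _ _ (begin
  lin p cx r xor v (y s i) r                                ≡⟨ cong (lin p cx r xor_) (sym y-part) ⟩
  lin p cx r xor bigxor (λ j → c (y s j) ∧ v (y s j) r)     ≡⟨ sym (combine-split v s c r) ⟩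
  combine v c r                                             ≡⟨ null r ⟩
  false                                                     ∎))
  where
  p : Matrix n
  p = xcols v s
  cx : Fin n → Bool
  cx k = c (x s k)
  other-y : ∀ j → j ≢ i → c (y s j) ≡ false
  other-y j j≢i = outside-support (c⊑T₀⁺ (y s j)) (trans (T₀⁺-y s i j) (δ-ne j≢i))
  y-i : c (y s i) ≡ true
  y-i = ¬-not λ y-i-zero → nonzero (ind c (within-T₀ y-i-zero) null)
    where
    within-T₀ : c (y s i) ≡ false → c ⊑ T₀ s
    within-T₀ y-i-zero = El-elim s (λ e → c e ≡ true → T₀ s e ≡ true)
      (λ j _ → T₀-x s j) (λ j h → ⊥-elim (false≢true (trans (sym (y-zero j)) h)))
      where
      y-zero : ∀ j → c (y s j) ≡ false
      y-zero j with j Fin.≟ i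
      ... | yes refl = y-i-zero
      ... | no j≢i   = other-y j j≢i
  y-part : bigxor (λ j → c (y s j) ∧ v (y s j) r) ≡ v (y s i) r
  y-part = trans (Σ-single _ i (λ j j≢i → cong (_∧ v (y s j) r) (other-y j j≢i)))
                 (cong (_∧ v (y s i) r) y-i)

-- Principal minors.  Nonsingular B F: the principal submatrix B[F] has
-- trivial kernel.

Nonsingular : ∀ {n} → Matrix n → (Fin n → Bool) → Set
Nonsingular {n} B F = ∀ (α : Fin n → Bool) → (∀ j → α j ≡ true → F j ≡ true) →
  (∀ k → F k ≡ true → bigxor (λ j → α j ∧ B k j) ≡ false) → ∀ j → α j ≡ false

principal-minor : ∀ {n} (s F : Fin n → Bool) (B : Matrix n) →
  Independent (colEntry B s) (T s F) ⇔ Nonsingular B F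
principal-minor {n} s F B = mk⇔ kernel-trivial independent
  where
  kernel-trivial : Independent (colEntry B s) (T s F) → Nonsingular B F
  kernel-trivial ind α α⊑F ker j = trans (sym (glue-y s cx α j)) (ind c c⊑T c-null (y s j))
    where
    w : Fin n → Bool
    w m = bigxor (λ j → α j ∧ B m j)
    cx : Fin n → Bool
    cx m = not (F m) ∧ w m
    c : Coeff n
    c = glue s cx α
    c⊑T : c ⊑ T s F
    c⊑T = El-elim s (λ e → c e ≡ true → T s F e ≡ true)
      (λ m h → trans (T-x s F m) (∧-trueˡ (trans (sym (glue-x s cx α m)) h)))
      (λ m h → trans (T-y s F m) (α⊑F m (trans (sym (glue-y s cx α m)) h)))
    cancel : ∀ f {w} → (f ≡ true → w ≡ false) → (not f ∧ w) xor w ≡ false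
    cancel true  h = h refl
    cancel false {w} h = xor-same w
    c-null : IsNull (colEntry B s) c
    c-null m = begin
      combine (colEntry B s) c m                         ≡⟨ combine-colEntry s B c m ⟩
      c (x s m) xor bigxor (λ j → c (y s j) ∧ B m j)     ≡⟨ cong₂ _xor_ (glue-x s cx α m) (Σ-cong (λ j → cong (_∧ B m j) (glue-y s cx α j))) ⟩
      cx m xor w m                                       ≡⟨ cancel (F m) (ker m) ⟩
      false                                              ∎
  independent : Nonsingular B F → Independent (colEntry B s) (T s F)
  independent nonsingular c c⊑T null = null-with-zero-y s B c null (nonsingular (c ∘ y s) α⊑F ker)
    where
    α⊑F : ∀ j → c (y s j) ≡ true → F j ≡ true
    α⊑F j h = trans (sym (T-y s F j)) (c⊑T (y s j) h)
    ker : ∀ k → F k ≡ true → bigxor (λ j → c (y s j) ∧ B k j) ≡ false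
    ker k Fk = begin
      bigxor (λ j → c (y s j) ∧ B k j)              ≡⟨ cong (_xor bigxor (λ j → c (y s j) ∧ B k j)) (sym x-zero) ⟩
      c (x s k) xor bigxor (λ j → c (y s j) ∧ B k j) ≡⟨ sym (combine-colEntry s B c k) ⟩
      combine (colEntry B s) c k                     ≡⟨ null k ⟩
      false                                          ∎
      where
      x-zero : c (x s k) ≡ false
      x-zero = outside-support (c⊑T (x s k)) (trans (T-x s F k) (cong not Fk))

-- The identity transversal is independent in every (I | A): B[∅] is nonsingular.
T₀-independent : ∀ {n} (A : Matrix n) s → ColIndep A s (toSub (T₀ s))
T₀-independent A s = from (colIndep-toSub A s (T₀ s))
  (from (principal-minor s (λ _ → false) A) (λ α α⊑∅ _ j → outside-support (α⊑∅ j) refl))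

nonsingular-single : ∀ {n} (B : Matrix n) i → Nonsingular B (λ j → δ j i) ⇔ B i i ≡ true
nonsingular-single B i = mk⇔ diagonal-one nonsingular
  where
  diagonal-one : Nonsingular B (λ j → δ j i) → B i i ≡ true
  diagonal-one ns = ¬-not λ Bii≡false →
    false≢true (trans (sym (ns (λ j → δ j i) (λ _ h → h) (ker Bii≡false) i)) (δ-refl i))
    where
    ker : B i i ≡ false → ∀ k → δ k i ≡ true → bigxor (λ j → δ j i ∧ B k j) ≡ false
    ker Bii≡false k k≡i rewrite δ-true k≡i = trans (Σ-pickˡ (B i) i) Bii≡false
  nonsingular : B i i ≡ true → Nonsingular B (λ j → δ j i)
  nonsingular Bii α α⊑i ker j with j Fin.≟ i
  ... | no j≢i   = outside-support (α⊑i j) (δ-ne j≢i)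
  ... | yes refl = begin
    α j                  ≡⟨ sym (∧-identityʳ _) ⟩
    α j ∧ true           ≡⟨ cong (α j ∧_) (sym Bii) ⟩
    α j ∧ B j j          ≡⟨ sym (Σ-single _ j (λ m m≢j → cong (_∧ B j m) (outside-support (α⊑i m) (δ-ne m≢j)))) ⟩
    bigxor (λ m → α m ∧ B j m) ≡⟨ ker j (δ-refl j) ⟩
    false                ∎

kernel₂-trivial : ∀ p q r t α γ → (p ∧ t) xor (q ∧ r) ≡ true →
  (α ∧ p) xor (γ ∧ q) ≡ false → (α ∧ r) xor (γ ∧ t) ≡ false → (α ≡ false) × (γ ≡ false)
kernel₂-trivial _     _     _     _     false false _  _  _  = refl , refl
kernel₂-trivial true  _     _     _     true  false _  () _
kernel₂-trivial false _     true  _     true  false _  _  ()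
kernel₂-trivial false false false _     true  false () _  _
kernel₂-trivial false true  false _     true  false () _  _
kernel₂-trivial _     true  _     _     false true  _  () _
kernel₂-trivial _     false _     true  false true  _  _  ()
kernel₂-trivial false false _     false false true  () _  _
kernel₂-trivial true  false _     false false true  () _  _
kernel₂-trivial true  false _     _     true  true  _  () _
kernel₂-trivial false true  _     _     true  true  _  () _
kernel₂-trivial _     _     true  false true  true  _  _  ()
kernel₂-trivial _     _     false true  true  true  _  _  ()
kernel₂-trivial true  true  true  true  true  true  () _  _
kernel₂-trivial false false false false true  true  () _  _

kernel₂-witness : ∀ p q r t → (p ∧ t) xor (q ∧ r) ≡ false →
  Σ Bool λ α → Σ Bool λ γ → ((α ∧ p) xor (γ ∧ q) ≡ false) × ((α ∧ r) xor (γ ∧ t) ≡ false) × (α ∨ γ ≡ true)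
kernel₂-witness false false false false _ = true  , false , refl , refl , refl
kernel₂-witness false false false true  _ = true  , false , refl , refl , refl
kernel₂-witness false false true  false _ = false , true  , refl , refl , refl
kernel₂-witness false false true  true  _ = true  , true  , refl , refl , refl
kernel₂-witness false true  false false _ = true  , false , refl , refl , refl
kernel₂-witness false true  false true  _ = true  , false , refl , refl , refl
kernel₂-witness false true  true  _     ()
kernel₂-witness true  false false false _ = false , true  , refl , refl , refl
kernel₂-witness true  false false true  ()
kernel₂-witness true  false true  false _ = false , true  , refl , refl , refl
kernel₂-witness true  false true  true  ()
kernel₂-witness true  true  false false _ = true  , true  , refl , refl , refl
kernel₂-witness true  true  false true  ()
kernel₂-witness true  true  true  false ()
kernel₂-witness true  true  true  true  _ = true  , true  , refl , refl , refl

pairSet : ∀ {n} → Fin n → Fin n → Fin n → Bool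
pairSet i k j = δ j i ∨ δ j k

pairSet-elim : ∀ {n ℓ} {i k : Fin n} (P : Fin n → Set ℓ) → P i → P k → ∀ m → pairSet i k m ≡ true → P m
pairSet-elim {i = i} P Pi Pk m m∈ik with δ m i in m≡i
... | true  rewrite δ-true m≡i = Pi
... | false rewrite δ-true m∈ik = Pk

pairVec : ∀ {n} → Fin n → Fin n → Bool → Bool → Fin n → Bool
pairVec i k a g j = (δ j i ∧ a) xor (δ j k ∧ g)

pairVec-i : ∀ {n} {i k : Fin n} a g → i ≢ k → pairVec i k a g i ≡ a
pairVec-i {i = i} {k} a g i≢k =
  trans (cong₂ (λ d d' → (d ∧ a) xor (d' ∧ g)) (δ-refl i) (δ-ne i≢k)) (xor-identityʳ a)

pairVec-k : ∀ {n} {i k : Fin n} a g → i ≢ k → pairVec i k a g k ≡ g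
pairVec-k {i = i} {k} a g i≢k = cong₂ (λ d d' → (d ∧ a) xor (d' ∧ g)) (δ-ne (i≢k ∘ sym)) (δ-refl k)

pairVec⊑pairSet : ∀ {n} (i k : Fin n) a g j → pairVec i k a g j ≡ true → pairSet i k j ≡ true
pairVec⊑pairSet i k a g j h with j Fin.≟ i | j Fin.≟ k
... | yes refl | _        = refl
... | no _     | yes refl = refl
... | no _     | no _     = ⊥-elim (false≢true h)

Σ-on-pair : ∀ {n} (i k : Fin n) → i ≢ k → ∀ (α : Fin n → Bool) → (∀ j → α j ≡ true → pairSet i k j ≡ true) →
  ∀ (row : Fin n → Bool) → bigxor (λ j → α j ∧ row j) ≡ (α i ∧ row i) xor (α k ∧ row k)
Σ-on-pair i k i≢k α α⊑ik row = Σ-pair (λ j → α j ∧ row j) i k i≢k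
  (λ j j≢i j≢k → cong (_∧ row j) (outside-support (α⊑ik j) (cong₂ _∨_ (δ-ne j≢i) (δ-ne j≢k))))

det₂ : ∀ {n} → Matrix n → Fin n → Fin n → Bool
det₂ B i k = (B i i ∧ B k k) xor (B i k ∧ B k i)

nonsingular-pair : ∀ {n} (B : Matrix n) i k → i ≢ k → Nonsingular B (pairSet i k) ⇔ det₂ B i k ≡ true
nonsingular-pair {n} B i k i≢k = mk⇔ det-one nonsingular
  where
  pairSet-i : pairSet i k i ≡ true
  pairSet-i = cong (_∨ δ i k) (δ-refl i)
  pairSet-k : pairSet i k k ≡ true
  pairSet-k = trans (cong (δ k i ∨_) (δ-refl k)) (∨-zeroʳ (δ k i))
  nonsingular : det₂ B i k ≡ true → Nonsingular B (pairSet i k)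
  nonsingular det α α⊑ik ker j with j Fin.≟ i | j Fin.≟ k | on-pair
    where
    on-pair : (α i ≡ false) × (α k ≡ false)
    on-pair = kernel₂-trivial (B i i) (B i k) (B k i) (B k k) (α i) (α k) det
      (trans (sym (Σ-on-pair i k i≢k α α⊑ik (B i))) (ker i pairSet-i))
      (trans (sym (Σ-on-pair i k i≢k α α⊑ik (B k))) (ker k pairSet-k))
  ... | yes refl | _        | αi , _  = αi
  ... | no _     | yes refl | _ , αk  = αk
  ... | no j≢i   | no j≢k   | _       = outside-support (α⊑ik j) (cong₂ _∨_ (δ-ne j≢i) (δ-ne j≢k))
  -- a vanishing determinant yields a nonzero kernel vector supported in {i, k}
  det-one : Nonsingular B (pairSet i k) → det₂ B i k ≡ true
  det-one ns with det₂ B i k in det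
  ... | true  = refl
  ... | false with kernel₂-witness (B i i) (B i k) (B k i) (B k k) det
  ...   | a , g , eq-i , eq-k , nonzero = trans (sym vanishes) nonzero
    where
    α : Fin n → Bool
    α = pairVec i k a g
    ker : ∀ m → pairSet i k m ≡ true → bigxor (λ j → α j ∧ B m j) ≡ false
    ker m m∈ik = trans (Σ-on-pair i k i≢k α (pairVec⊑pairSet i k a g) (B m))
      (trans (cong₂ (λ u u' → (u ∧ B m i) xor (u' ∧ B m k)) (pairVec-i a g i≢k) (pairVec-k a g i≢k))
             (pairSet-elim (λ m → (a ∧ B m i) xor (g ∧ B m k) ≡ false) eq-i eq-k m m∈ik))
    vanishes : a ∨ g ≡ false
    vanishes = cong₂ _∨_ (trans (sym (pairVec-i a g i≢k)) (ns α (pairVec⊑pairSet i k a g) ker i))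
                         (trans (sym (pairVec-k a g i≢k)) (ns α (pairVec⊑pairSet i k a g) ker k))

-- A symmetric matrix over GF(2) is determined by which transversals T s F
-- are independent in (I | B): the diagonal by the 1×1 minors, the
-- off-diagonal entries by the 2×2 minors, since B i k ∧ B k i = B i k.
symmetric-determined : ∀ {n} s (B B' : Matrix n) → IsSymmetric B → IsSymmetric B' →
  (∀ F → Independent (colEntry B s) (T s F) ⇔ Independent (colEntry B' s) (T s F)) →
  ∀ i k → B i k ≡ B' i k
symmetric-determined s B B' symB symB' same = entry
  where
  minors : ∀ F → Nonsingular B F ⇔ Nonsingular B' F
  minors F = ⇔.trans (⇔.sym (principal-minor s F B)) (⇔.trans (same F) (principal-minor s F B'))
  diagonal : ∀ i → B i i ≡ B' i i
  diagonal i = bool-ext (⇔.trans (⇔.sym (nonsingular-single B i)) (⇔.trans (minors _) (nonsingular-single B' i)))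
  det-symmetric : ∀ (M : Matrix _) → IsSymmetric M → ∀ i k → det₂ M i k ≡ (M i i ∧ M k k) xor M i k
  det-symmetric M symM i k = cong ((M i i ∧ M k k) xor_) (trans (cong (M i k ∧_) (symM k i)) (∧-idem (M i k)))
  entry : ∀ i k → B i k ≡ B' i k
  entry i k with i Fin.≟ k
  ... | yes refl = diagonal i
  ... | no i≢k   = xor-cancelˡ (B i i ∧ B k k) (begin
    (B i i ∧ B k k) xor B i k     ≡⟨ sym (det-symmetric B symB i k) ⟩
    det₂ B i k                    ≡⟨ bool-ext (⇔.trans (⇔.sym (nonsingular-pair B i k i≢k))
                                      (⇔.trans (minors _) (nonsingular-pair B' i k i≢k))) ⟩
    det₂ B' i k                   ≡⟨ det-symmetric B' symB' i k ⟩
    (B' i i ∧ B' k k) xor B' i k  ≡⟨ cong₂ (λ a b → (a ∧ b) xor B' i k) (sym (diagonal i)) (sym (diagonal k)) ⟩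
    (B i i ∧ B k k) xor B' i k    ∎)

-- The symplectic form ω pairs the two elements of each class; the null
-- space of (I | B) is ω-isotropic exactly when B is symmetric.

ω : ∀ {n} → Coeff n → Coeff n → Bool
ω c d = bigxor (λ j → (c (j , false) ∧ d (j , true)) xor (c (j , true) ∧ d (j , false)))

ω-split : ∀ {n} s (c d : Coeff n) → ω c d ≡ bigxor (λ j → (c (x s j) ∧ d (y s j)) xor (c (y s j) ∧ d (x s j)))
ω-split s c d = Σ-cong per-class
  where
  per-class : ∀ j → ((c (j , false) ∧ d (j , true)) xor (c (j , true) ∧ d (j , false)))
                  ≡ ((c (x s j) ∧ d (y s j)) xor (c (y s j) ∧ d (x s j)))
  per-class j with s j
  ... | true  = xor-comm (c (j , false) ∧ d (j , true)) (c (j , true) ∧ d (j , false))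
  ... | false = refl

null-x-coordinates : ∀ {n} s (A : Matrix n) c → IsNull (colEntry A s) c →
  ∀ r → c (x s r) ≡ bigxor (λ j → c (y s j) ∧ A r j)
null-x-coordinates s A c null r = xor≡false⇒≡ _ _ (trans (sym (combine-colEntry s A c r)) (null r))

null-isotropic : ∀ {n} s (A : Matrix n) → IsSymmetric A → ∀ c d →
  IsNull (colEntry A s) c → IsNull (colEntry A s) d → ω c d ≡ false
null-isotropic s A symA c d c-null d-null = begin
  ω c d
    ≡⟨ ω-split s c d ⟩
  bigxor (λ r → (c (x s r) ∧ d (y s r)) xor (c (y s r) ∧ d (x s r)))
    ≡⟨ Σ-cong (λ r → cong₂ _xor_ (cong (_∧ d (y s r)) (null-x-coordinates s A c c-null r))
                                 (cong (c (y s r) ∧_) (null-x-coordinates s A d d-null r))) ⟩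
  bigxor (λ r → (S c r ∧ d (y s r)) xor (c (y s r) ∧ S d r))
    ≡⟨ Σ-xor (λ r → S c r ∧ d (y s r)) (λ r → c (y s r) ∧ S d r) ⟩
  bigxor (λ r → S c r ∧ d (y s r)) xor bigxor (λ r → c (y s r) ∧ S d r)
    ≡⟨ cong₂ _xor_ left right ⟩
  double xor double
    ≡⟨ xor-same double ⟩
  false ∎
  where
  S : Coeff _ → Fin _ → Bool
  S e r = bigxor (λ j → e (y s j) ∧ A r j)
  double : Bool
  double = bigxor (λ r → bigxor (λ j → c (y s j) ∧ (d (y s r) ∧ A j r)))
  left : bigxor (λ r → S c r ∧ d (y s r)) ≡ double
  left = Σ-cong λ r → trans (Σ-scaleʳ (d (y s r)) (λ j → c (y s j) ∧ A r j)) (Σ-cong λ j →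
           trans (∧-assoc (c (y s j)) (A r j) (d (y s r)))
                 (cong (c (y s j) ∧_) (trans (∧-comm (A r j) _) (cong (d (y s r) ∧_) (symA r j)))))
  right : bigxor (λ r → c (y s r) ∧ S d r) ≡ double
  right = trans (Σ-cong (λ r → Σ-scaleˡ (c (y s r)) (λ j → d (y s j) ∧ A r j)))
                (Σ-swap (λ r j → c (y s r) ∧ (d (y s j) ∧ A r j)))

isotropic⇒symmetric : ∀ {n} s (B : Matrix n) →
  (∀ c d → IsNull (colEntry B s) c → IsNull (colEntry B s) d → ω c d ≡ false) → IsSymmetric B
isotropic⇒symmetric {n} s B isotropic i k =
  xor≡false⇒≡ (B i k) (B k i) (trans (sym (ω-basic k i)) (isotropic (basic k) (basic i) (basic-null k) (basic-null i)))
  where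
  -- the null vector expressing the column of y s i through T₀ s
  basic : Fin n → Coeff n
  basic i = glue s (λ k → B k i) (λ j → δ j i)
  basic-x : ∀ i k → basic i (x s k) ≡ B k i
  basic-x i = glue-x s (λ k → B k i) (λ j → δ j i)
  basic-y : ∀ i j → basic i (y s j) ≡ δ j i
  basic-y i = glue-y s (λ k → B k i) (λ j → δ j i)
  basic-null : ∀ i → IsNull (colEntry B s) (basic i)
  basic-null i k = begin
    combine (colEntry B s) (basic i) k
      ≡⟨ combine-colEntry s B (basic i) k ⟩
    basic i (x s k) xor bigxor (λ j → basic i (y s j) ∧ B k j)
      ≡⟨ cong₂ _xor_ (basic-x i k) (trans (Σ-cong (λ j → cong (_∧ B k j) (basic-y i j))) (Σ-pickˡ (B k) i)) ⟩
    B k i xor B k i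
      ≡⟨ xor-same (B k i) ⟩
    false ∎
  ω-basic : ∀ a b → ω (basic a) (basic b) ≡ B b a xor B a b
  ω-basic a b = begin
    ω (basic a) (basic b)
      ≡⟨ ω-split s (basic a) (basic b) ⟩
    bigxor (λ j → (basic a (x s j) ∧ basic b (y s j)) xor (basic a (y s j) ∧ basic b (x s j)))
      ≡⟨ Σ-cong (λ j → cong₂ _xor_ (cong₂ _∧_ (basic-x a j) (basic-y b j))
                                   (cong₂ _∧_ (basic-y a j) (basic-x b j))) ⟩
    bigxor (λ j → (B j a ∧ δ j b) xor (δ j a ∧ B j b))
      ≡⟨ Σ-xor (λ j → B j a ∧ δ j b) (λ j → δ j a ∧ B j b) ⟩
    bigxor (λ j → B j a ∧ δ j b) xor bigxor (λ j → δ j a ∧ B j b)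
      ≡⟨ cong₂ _xor_ (Σ-pickʳ (λ j → B j a) b) (Σ-pickˡ (λ j → B j b) a) ⟩
    B b a xor B a b ∎

-- The rank of (I | A) is n.

T₀-extension-dependent : ∀ {n} (A : Matrix n) s j → ¬ ColIndep A s (insert (y s j) (toSub (T₀ s)))
T₀-extension-dependent {n} A s j ind =
  false≢true (trans (sym (to (colIndep⇔independent A s _) ind c c⊑ c-null (y s j)))
                    (trans (glue-y s cx cy j) (δ-refl j)))
  where
  cx cy : Fin n → Bool
  cx m = A m j
  cy m = δ m j
  c : Coeff n
  c = glue s cx cy
  c⊑ : c ⊑ ⟦ insert (y s j) (toSub (T₀ s)) ⟧
  c⊑ = El-elim s _
    (λ m _ → ⟦insert⟧-old (y s j) _ (x s m) (trans (⟦toSub⟧ (T₀ s) (x s m)) (T₀-x s m)))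
    (λ m h → subst (λ m → ⟦ insert (y s j) (toSub (T₀ s)) ⟧ (y s m) ≡ true)
                   (sym (δ-true (trans (sym (glue-y s cx cy m)) h))) (⟦insert⟧-new (y s j) _))
  c-null : IsNull (colEntry A s) c
  c-null r = begin
    combine (colEntry A s) c r                        ≡⟨ combine-colEntry s A c r ⟩
    c (x s r) xor bigxor (λ m → c (y s m) ∧ A r m)
      ≡⟨ cong₂ _xor_ (glue-x s cx cy r) (trans (Σ-cong (λ m → cong (_∧ A r m) (glue-y s cx cy m))) (Σ-pickˡ (A r) j)) ⟩
    A r j xor A r j                                   ≡⟨ xor-same (A r j) ⟩
    false                                             ∎

-- No independent set of the matroid 𝒬(A, s) is larger than T₀ s: otherwise
-- augmenting T₀ s would add some y s j.
rank-bound : ∀ {n} (A : Matrix n) s → IsMatroid (ColIndep A s) →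
  ∀ Y → ColIndep A s Y → ¬ size (toSub (T₀ s)) < size Y
rank-bound A s matroid Y indY larger with IsMatroid.augment matroid _ Y (T₀-independent A s) indY larger
... | e , _ , e∉T₀ , ind = El-elim s (λ e → ¬ e ∈ₛ toSub (T₀ s) → ¬ ColIndep A s (insert e (toSub (T₀ s))))
  (λ m x∉T₀ _ → x∉T₀ (trans (⟦toSub⟧ (T₀ s) (x s m)) (T₀-x s m)))
  (λ m _ → T₀-extension-dependent A s m) e e∉T₀ ind

IsMatroid-resp : ∀ {n} {F G : Family n} → SameFam F G → IsMatroid F → IsMatroid G
IsMatroid-resp {n} {F} {G} F≐G m = record
  { empty-ind   = proj₁ (F≐G _) (IsMatroid.empty-ind m)
  ; down-closed = λ X Y Y⊆X GX → proj₁ (F≐G Y) (IsMatroid.down-closed m X Y Y⊆X (proj₂ (F≐G X) GX))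
  ; augment     = λ X Y GX GY lt → augmented (IsMatroid.augment m X Y (proj₂ (F≐G X) GX) (proj₂ (F≐G Y) GY) lt)
  }
  where
  augmented : ∀ {X Y} → (Σ (El n) λ e → e ∈ₛ Y × ¬ e ∈ₛ X × F (insert e X)) →
                         Σ (El n) λ e → e ∈ₛ Y × ¬ e ∈ₛ X × G (insert e X)
  augmented (e , e∈Y , e∉X , Fe) = e , e∈Y , e∉X , proj₁ (F≐G _) Fe

module Uniqueness {n : ℕ} (A A' : Matrix n) (s s' : Fin n → Bool)
  (symA : IsSymmetric A) (symA' : IsSymmetric A') (matroid' : IsMatroid (ColIndep A' s'))
  (agree : ∀ X → IsSubtransversal X → ColIndep A s X ⇔ ColIndep A' s' X) where

  v' : Columns n
  v' = colEntry A' s'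

  T₀-independent' : Independent v' (T₀ s)
  T₀-independent' = to (colIndep-toSub A' s' (T₀ s)) (to (agree _ (T-subtransversal s _)) (T₀-independent A s))

  -- T₀⁺ s i exceeds the rank of 𝒬(A', s'); its explicit dependency spans y s i.
  spanned : ∀ i → Σ (Fin n → Bool) λ β → ∀ r → v' (y s i) r ≡ lin (xcols v' s) β r
  spanned i = from-dependency (explicit-dependency A' s' _ λ ind →
                 rank-bound A' s' matroid' _ ind (size-T₀<size-T₀⁺ s' s i))
    where
    from-dependency : (Σ (Sub n) λ c → c ⊆ₛ toSub (T₀⁺ s i) × (∀ r → combo A' s' c r ≡ false) × ¬ c ≡ ∅ₛ) →
      Σ (Fin n → Bool) λ β → ∀ r → v' (y s i) r ≡ lin (xcols v' s) β r
    from-dependency (c , c⊆ , null , c≢∅) =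
      _ , column-in-span v' s i T₀-independent' ⟦ c ⟧ (λ e h → trans (sym (⟦toSub⟧ (T₀⁺ s i) e)) (c⊆ e h))
                         null (c≢∅ ∘ ≡∅ₛ c)

  -- Q' = (I | B) with the identity columns on T₀ s.
  B : Matrix n
  B k i = proj₁ (spanned i) k

  null-spaces : ∀ c → IsNull v' c ⇔ IsNull (colEntry B s) c
  null-spaces = null-space-via-basis v' s B (transversal-free v' s T₀-independent') (λ i → proj₂ (spanned i))

  B-symmetric : IsSymmetric B
  B-symmetric = isotropic⇒symmetric s B λ c d c-null d-null →
    null-isotropic s' A' symA' c d (from (null-spaces c) c-null) (from (null-spaces d) d-null)

  independent-B⇔v' : ∀ X → Independent (colEntry B s) X ⇔ Independent v' X
  independent-B⇔v' = same-null-space (colEntry B s) v' (λ c → ⇔.sym (null-spaces c))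

  B≡A : ∀ i k → B i k ≡ A i k
  B≡A = symmetric-determined s B A B-symmetric symA λ F →
    ⇔.trans (independent-B⇔v' (T s F))
    (⇔.trans (⇔.sym (colIndep-toSub A' s' (T s F)))
    (⇔.trans (⇔.sym (agree _ (T-subtransversal s F)))
             (colIndep-toSub A s (T s F))))

  representation-unique : ∀ X → ColIndep A s X ⇔ ColIndep A' s' X
  representation-unique X =
    ⇔.trans (colIndep⇔independent A s X)
    (⇔.trans (same-null-space (colEntry A s) (colEntry B s)
                              (colEntry-null-cong s A B (λ i k → sym (B≡A i k))) ⟦ X ⟧)
    (⇔.trans (independent-B⇔v' ⟦ X ⟧)
             (⇔.sym (colIndep⇔independent A' s' X))))

sameFam⇒⇔ : ∀ {n} {F G : Family n} → SameFam F G → ∀ X → F X ⇔ G X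
sameFam⇒⇔ F≐G X = mk⇔ (proj₁ (F≐G X)) (proj₂ (F≐G X))

agree-on-subtransversals : ∀ {n} {F G Z : Family n} → SameFam (𝒵 F) Z → SameFam (𝒵 G) Z →
  ∀ X → IsSubtransversal X → F X ⇔ G X
agree-on-subtransversals 𝒵F≐Z 𝒵G≐Z X st =
  mk⇔ (λ FX → proj₂ (proj₂ (𝒵G≐Z X) (proj₁ (𝒵F≐Z X) (st , FX))))
      (λ GX → proj₂ (proj₂ (𝒵F≐Z X) (proj₁ (𝒵G≐Z X) (st , GX))))

-- Existence: the sheltering matroid witnessing that Z is strongly binary.
proposition24 : (n : ℕ) (Z : Family n) → Is2Matroid Z → IsStronglyBinary2Matroid Z →
    Σ (Family n) λ Q → IsStronglyBinarySheltering Q × SameFam (𝒵 Q) Z ×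
      ((Q' : Family n) → IsStronglyBinarySheltering Q' → SameFam (𝒵 Q') Z → SameFam Q' Q)
proposition24 n Z _ (M , M-sb@(_ , (A , s , symA , M≐A)) , 𝒵M≐Z) = M , M-sb , 𝒵M≐Z , unique
  where
  unique : (Q' : Family n) → IsStronglyBinarySheltering Q' → SameFam (𝒵 Q') Z → SameFam Q' M
  unique Q' (shQ' , (A' , s' , symA' , Q'≐A')) 𝒵Q'≐Z X = to Q'⇔M , from Q'⇔M
    where
    agree : ∀ X → IsSubtransversal X → ColIndep A s X ⇔ ColIndep A' s' X
    agree X st = ⇔.trans (⇔.sym (sameFam⇒⇔ M≐A X))
                 (⇔.trans (agree-on-subtransversals 𝒵M≐Z 𝒵Q'≐Z X st) (sameFam⇒⇔ Q'≐A' X))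
    matroid' : IsMatroid (ColIndep A' s')
    matroid' = IsMatroid-resp Q'≐A' (IsSheltering.matroid shQ')
    Q'⇔M : Q' X ⇔ M X
    Q'⇔M = ⇔.trans (sameFam⇒⇔ Q'≐A' X)
           (⇔.trans (⇔.sym (Uniqueness.representation-unique A A' s s' symA symA' matroid' agree X))
                    (⇔.sym (sameFam⇒⇔ M≐A X)))
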